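{- Let $m\ge3$, let $O_{m+1}$ be the Odd graph with vertex set $X$, $x_0=\{1,\ldots,m\}$, adjacency matrix $A_1$ and dual idempotents $E^*_0,\ldots,E^*_m$ with respect to $x_0$. Let $i,k$ be integers with $0\le i,k\le m$ and $i+k\le m$, and put $P=E^*_{i+k}A_1E^*_{i+k-1}A_1E^*_{i+k-2}\cdots E^*_{i+1}A_1E^*_i$. Then: (i) if $i$ is even and $k$ is odd, $P=\big((\tfrac{k-1}{2})!\big)^2\tfrac{k+1}{2}\,M^{\frac{k-1}{2},\frac{k-1}{2}}_{\frac{i+k-1}{2},\frac{2m-i}{2}}$; (ii) if $i$ is even and $k\ge2$ is even, $P=\big((\tfrac{k}{2})!\big)^2\,M^{\frac{2m-k}{2},\frac{2m-i-k}{2}}_{\frac{2m-i-k}{2},\frac{2m-i}{2}}$; (iii) if $i$ is odd and $k$ is odd, $P=\big((\tfrac{k-1}{2})!\big)^2\tfrac{k+1}{2}\,M^{\frac{k-1}{2},0}_{\frac{2m-i-k}{2},\frac{i-1}{2}}$; (iv) if $i$ is odd and $k\ge2$ is even, $P=\big((\tfrac{k}{2})!\big)^2\,M^{\frac{2m-k}{2},\frac{i-1}{2}}_{\frac{i+k-1}{2},\frac{i-1}{2}}$.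
   Context: $S=\{1,\ldots,2m+1\}$, $X$ is the set of $m$-subsets of $S$; $O_{m+1}$ has vertices adjacent iff disjoint; path-length distance is $\partial(x,y)=2|x\cap y|+1$ if $|x\cap y|\le\lfloor\frac{m-1}{2}\rfloor$ and $2m-2|x\cap y|$ otherwise. $E^*_j$ is the diagonal matrix with $(y,y)$-entry $1$ iff $\partial(x_0,y)=j$. For integers $a,b,t,p$, $M^{t,p}_{a,b}\in\mathrm{Mat}_X(\mathbb{C})$ has $(x,y)$-entry $1$ if $|x_0\cap x|=a$, $|x_0\cap y|=b$, $|x\cap y|=t$, $|x_0\cap x\cap y|=p$, and $0$ otherwise. -}

module Defs where

open import Data.Nat using (ℕ; zero; suc; _+_; _*_; _∸_; _≡ᵇ_; _<ᵇ_; _≤ᵇ_; ⌊_/2⌋)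
open import Data.Nat.Properties using (_≟_)
open import Data.Bool using (Bool; true; false; if_then_else_; _∧_)
import Data.Bool.Properties as BoolP
open import Data.Fin using (Fin; toℕ)
open import Data.Fin.Subset using (Subset; _∩_; ∣_∣)
open import Data.Vec using (Vec; []; _∷_; tabulate)
open import Data.Vec.Properties using (≡-dec)
open import Data.List using (List; []; _∷_; map; _++_; filter)
open import Data.Nat.ListAction using (sum)
open import Relation.Nullary using (does)
open import Relation.Binary.PropositionalEquality using (_≡_)

-- The ground set S = {1,…,2m+1} is modelled as Fin (2m+1) (element j+1 ↦ j).
Ground : ℕ → ℕ
Ground m = suc (2 * m)

Sub : ℕ → Set
Sub m = Subset (Ground m)

allSubsets : (n : ℕ) → List (Subset n)
allSubsets zero    = [] ∷ []
allSubsets (suc n) = map (true ∷_) (allSubsets n) ++ map (false ∷_) (allSubsets n)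

Xs : (m : ℕ) → List (Sub m)
Xs m = filter (λ s → ∣ s ∣ ≟ m) (allSubsets (Ground m))

-- x₀ = {1,…,m}, i.e. {0,…,m-1} in Fin (2m+1)
x₀ : (m : ℕ) → Sub m
x₀ m = tabulate (λ j → toℕ j <ᵇ m)

-- path-length distance in O_{m+1}, via the formula of the paper
dist : (m : ℕ) → Sub m → Sub m → ℕ
dist m x y = if t ≤ᵇ ⌊ m ∸ 1 /2⌋ then 2 * t + 1 else 2 * m ∸ 2 * t
  where t = ∣ x ∩ y ∣

-- Matrices indexed by X with entries in ℕ (all matrices here have
-- nonnegative integer entries; only entries at m-subsets matter)
Mat : ℕ → Set
Mat m = Sub m → Sub m → ℕ

mul : (m : ℕ) → Mat m → Mat m → Mat m
mul m A B x y = sum (map (λ z → A x z * B z y) (Xs m))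

A₁ : (m : ℕ) → Mat m
A₁ m x y = if ∣ x ∩ y ∣ ≡ᵇ 0 then 1 else 0

E* : (m : ℕ) → ℕ → Mat m
E* m j x y = if does (≡-dec BoolP._≟_ x y) ∧ (dist m (x₀ m) y ≡ᵇ j) then 1 else 0

Pchain : (m i k : ℕ) → Mat m
Pchain m i zero    = E* m i
Pchain m i (suc k) = mul m (E* m (i + suc k)) (mul m (A₁ m) (Pchain m i k))

-- M^{t,p}_{a,b}
M : (m a b t p : ℕ) → Mat m
M m a b t p x y =
  if (∣ x₀ m ∩ x ∣ ≡ᵇ a) ∧ (∣ x₀ m ∩ y ∣ ≡ᵇ b) ∧ (∣ x ∩ y ∣ ≡ᵇ t) ∧ (∣ x₀ m ∩ x ∩ y ∣ ≡ᵇ p)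
  then 1 else 0

scale : (m : ℕ) → ℕ → Mat m → Mat m
scale m c A x y = c * A x y

MatEq : (m : ℕ) → Mat m → Mat m → Set
MatEq m A B = (x y : Sub m) → ∣ x ∣ ≡ m → ∣ y ∣ ≡ m → A x y ≡ B x y

module Submission where

-- Multiplying by A₁ replaces the
-- entry at (w, y) by a sum over the neighbours w = ∁ x ∖ {j}, j ∉ x, of x, and the profile
-- (|x₀ ∩ w|, |x₀ ∩ y|, |w ∩ y|, |x₀ ∩ w ∩ y|) of such a w only depends on whether j lies in
-- x₀ and in y.  So the sum is a weighted count over four types of points, with weights read
-- off the Venn diagram of x₀, y and x.  The factor E*_{i+k+1} fixes |x₀ ∩ x|, which decides
-- whether j ∈ x₀; of the two remaining types one contradicts |x₀| = |y| = |x| = m, and the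
-- other contributes exactly s + 1 neighbours, precisely when (x, y) has the next profile.
-- Alternating between even and odd k, this gives the factors (s!)² (s + 1) and ((s + 1)!)².

open import Data.Bool using (Bool; true; false; if_then_else_; _∧_; T)
import Data.Bool.Properties as Bool
open import Data.Empty using (⊥-elim)
open import Data.Fin using (toℕ)
open import Data.Fin.Subset using (Subset; _∩_; ∣_∣; ∁)
open import Data.Fin.Subset.Properties
  using (∣p∣≤n; ∣∁p∣≡n∸∣p∣; ∣p∩q∣≤∣p∣; ∣p∩q∣≤∣q∣; ∩-idem; ∩-comm; ∩-assoc)
open import Data.List using (List; []; _∷_; map; filter; _++_)
open import Data.List.Properties using (map-++; map-∘; map-cong-local)
import Data.List.Relation.Unary.All as All
open import Data.List.Relation.Unary.All.Properties using (all-filter)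
open import Data.Nat
  using (ℕ; zero; suc; pred; _!; _+_; _*_; _∸_; _/_; _%_; _≤_; _<_; _^_; _≡ᵇ_; _≤ᵇ_; _<ᵇ_; ⌊_/2⌋; ⌈_/2⌉; z≤n; s≤s)
open import Data.Nat.DivMod using (m*n/n≡m; m≡m%n+[m/n]*n; m/n≤m)
open import Data.Nat.ListAction using (sum)
open import Data.Nat.ListAction.Properties using (sum-++)
open import Data.Nat.Properties
open import Data.Nat.Tactic.RingSolver using (solve-∀)
open import Data.Product using (_×_; _,_; proj₁; proj₂)
open import Data.Vec using ([]; _∷_; tabulate)
open import Data.Vec.Properties using (≡-dec; ∷-injectiveʳ)
open import Function using (_∘_)
open import Function.Bundles using (mk⇔)
open import Relation.Binary.PropositionalEquality
open import Relation.Nullary using (Dec; does; yes; no; ¬_; _×-dec_)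
open import Relation.Nullary.Decidable using (dec-true; dec-false; does-⇔)
open import Relation.Unary using (Pred; Decidable)

open import Defs

𝟙 : ∀ {ℓ} {P : Set ℓ} → Dec P → ℕ
𝟙 P? = if does P? then 1 else 0

𝟙-yes : ∀ {ℓ} {P : Set ℓ} (P? : Dec P) → P → 𝟙 P? ≡ 1
𝟙-yes P? p rewrite dec-true P? p = refl

𝟙-no : ∀ {ℓ} {P : Set ℓ} (P? : Dec P) → ¬ P → 𝟙 P? ≡ 0
𝟙-no P? ¬p rewrite dec-false P? ¬p = refl

𝟙-⇔ : ∀ {ℓ} {P Q : Set ℓ} (P? : Dec P) (Q? : Dec Q) → (P → Q) → (Q → P) → 𝟙 P? ≡ 𝟙 Q?
𝟙-⇔ P? Q? P→Q Q→P = cong (λ b → if b then 1 else 0) (does-⇔ (mk⇔ P→Q Q→P) P? Q?)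

*𝟙-no : ∀ {ℓ} {P : Set ℓ} d (P? : Dec P) → ¬ P → d * 𝟙 P? ≡ 0
*𝟙-no d P? ¬p = trans (cong (d *_) (𝟙-no P? ¬p)) (*-zeroʳ d)

*𝟙-⇔ : ∀ {ℓ} {P Q : Set ℓ} d s (P? : Dec P) (Q? : Dec Q) → (P → Q) → (Q → P) → (Q → d ≡ suc s) →
  d * 𝟙 P? ≡ suc s * 𝟙 Q?
*𝟙-⇔ d s P? Q? P→Q Q→P Q→d≡1+s with Q?
... | yes q = cong₂ _*_ (Q→d≡1+s q) (𝟙-yes P? (Q→P q))
... | no ¬q = trans (*𝟙-no d P? (¬q ∘ P→Q)) (sym (*-zeroʳ (suc s)))

sum-map-zero : ∀ {A : Set} (f : A → ℕ) (l : List A) → (∀ a → f a ≡ 0) → sum (map f l) ≡ 0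
sum-map-zero f []      f≡0 = refl
sum-map-zero f (a ∷ l) f≡0 rewrite f≡0 a = sum-map-zero f l f≡0

sum-map-filter : ∀ {A : Set} {ℓ} {P : Pred A ℓ} (P? : Decidable P) (g : A → ℕ) (l : List A) →
  sum (map g (filter P? l)) ≡ sum (map (λ a → if does (P? a) then g a else 0) l)
sum-map-filter P? g []      = refl
sum-map-filter P? g (a ∷ l) with does (P? a)
... | true  = cong (g a +_) (sum-map-filter P? g l)
... | false = sum-map-filter P? g l

Σsubsets : ∀ n → (Subset n → ℕ) → ℕ
Σsubsets n f = sum (map f (allSubsets n))

Σsubsets-suc : ∀ n (f : Subset (suc n) → ℕ) →
  Σsubsets (suc n) f ≡ Σsubsets n (λ s → f (true ∷ s)) + Σsubsets n (λ s → f (false ∷ s))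
Σsubsets-suc n f = begin
  sum (map f (map (true ∷_) S ++ map (false ∷_) S))
    ≡⟨ cong sum (map-++ f (map (true ∷_) S) (map (false ∷_) S)) ⟩
  sum (map f (map (true ∷_) S) ++ map f (map (false ∷_) S))
    ≡⟨ sum-++ (map f (map (true ∷_) S)) _ ⟩
  sum (map f (map (true ∷_) S)) + sum (map f (map (false ∷_) S))
    ≡⟨ sym (cong₂ _+_ (cong sum (map-∘ S)) (cong sum (map-∘ S))) ⟩
  Σsubsets n (λ s → f (true ∷ s)) + Σsubsets n (λ s → f (false ∷ s)) ∎
  where open ≡-Reasoning
        S = allSubsets n

Σsubsets-zero : ∀ n (f : Subset n → ℕ) → (∀ s → f s ≡ 0) → Σsubsets n f ≡ 0
Σsubsets-zero n f = sum-map-zero f (allSubsets n)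

Σsubsets-point : ∀ n (x : Subset n) (f : Subset n → ℕ) → (∀ s → s ≢ x → f s ≡ 0) → Σsubsets n f ≡ f x
Σsubsets-point zero    []      f f≡0 = +-identityʳ (f [])
Σsubsets-point (suc n) (true ∷ x) f f≡0 = begin
  Σsubsets (suc n) f
    ≡⟨ Σsubsets-suc n f ⟩
  Σsubsets n (λ s → f (true ∷ s)) + Σsubsets n (λ s → f (false ∷ s))
    ≡⟨ cong₂ _+_ (Σsubsets-point n x _ (λ s s≢x → f≡0 (true ∷ s) (s≢x ∘ ∷-injectiveʳ)))
                 (Σsubsets-zero n _ (λ s → f≡0 (false ∷ s) λ ())) ⟩
  f (true ∷ x) + 0
    ≡⟨ +-identityʳ _ ⟩
  f (true ∷ x) ∎
  where open ≡-Reasoning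
Σsubsets-point (suc n) (false ∷ x) f f≡0 = begin
  Σsubsets (suc n) f
    ≡⟨ Σsubsets-suc n f ⟩
  Σsubsets n (λ s → f (true ∷ s)) + Σsubsets n (λ s → f (false ∷ s))
    ≡⟨ cong₂ _+_ (Σsubsets-zero n _ (λ s → f≡0 (true ∷ s) λ ()))
                 (Σsubsets-point n x _ (λ s s≢x → f≡0 (false ∷ s) (s≢x ∘ ∷-injectiveʳ))) ⟩
  f (false ∷ x) ∎
  where open ≡-Reasoning

-- Neighbours in the Odd graph

-- Σ of H over the sets ∁ x ∖ {j} with j ∉ x, i.e. over the neighbours of an m-set x
Σneighbours : ∀ {n} → Subset n → (Subset n → ℕ) → ℕ
Σneighbours []          H = 0
Σneighbours (true ∷ x)  H = Σneighbours x (λ s → H (false ∷ s))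
Σneighbours (false ∷ x) H = H (false ∷ ∁ x) + Σneighbours x (λ s → H (true ∷ s))

Σneighbours-full : ∀ {n} (x : Subset n) H → ∣ x ∣ ≡ n → Σneighbours x H ≡ 0
Σneighbours-full []          H _ = refl
Σneighbours-full (true ∷ x)  H eq = Σneighbours-full x _ (suc-injective eq)
Σneighbours-full (false ∷ x) H eq = ⊥-elim (<-irrefl eq (s≤s (∣p∣≤n x)))

Σneighbours-cong : ∀ {n} (x : Subset n) {H H′} → (∀ s → H s ≡ H′ s) → Σneighbours x H ≡ Σneighbours x H′
Σneighbours-cong []          eq = refl
Σneighbours-cong (true ∷ x)  eq = Σneighbours-cong x (λ s → eq (false ∷ s))
Σneighbours-cong (false ∷ x) eq = cong₂ _+_ (eq _) (Σneighbours-cong x (λ s → eq (true ∷ s)))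

Σneighbours-* : ∀ {n} (x : Subset n) c H → Σneighbours x (λ s → c * H s) ≡ c * Σneighbours x H
Σneighbours-* []          c H = sym (*-zeroʳ c)
Σneighbours-* (true ∷ x)  c H = Σneighbours-* x c _
Σneighbours-* (false ∷ x) c H =
  trans (cong (c * H (false ∷ ∁ x) +_) (Σneighbours-* x c _)) (sym (*-distribˡ-+ c _ _))

disjointOfSize : ∀ {n} → ℕ → Subset n → (Subset n → ℕ) → Subset n → ℕ
disjointOfSize c x H s = if does (∣ s ∣ ≟ c) then (if ∣ x ∩ s ∣ ≡ᵇ 0 then 1 else 0) * H s else 0

Σdisjoint : ∀ n → ℕ → Subset n → (Subset n → ℕ) → ℕ
Σdisjoint n c x H = Σsubsets n (disjointOfSize c x H)

if-const : ∀ {A : Set} b {x : A} → (if b then x else x) ≡ x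
if-const true  = refl
if-const false = refl

Σdisjoint-true∷ : ∀ n c (x : Subset n) H →
  Σdisjoint (suc n) c (true ∷ x) H ≡ Σdisjoint n c x (λ s → H (false ∷ s))
Σdisjoint-true∷ n c x H =
  trans (Σsubsets-suc n _) (cong (_+ Σdisjoint n c x (λ s → H (false ∷ s))) (Σsubsets-zero n _ (λ s → if-const (does (suc ∣ s ∣ ≟ c)))))

Σdisjoint-false∷-zero : ∀ n (x : Subset n) H →
  Σdisjoint (suc n) 0 (false ∷ x) H ≡ Σdisjoint n 0 x (λ s → H (false ∷ s))
Σdisjoint-false∷-zero n x H =
  trans (Σsubsets-suc n _) (cong (_+ Σdisjoint n 0 x (λ s → H (false ∷ s))) (Σsubsets-zero n (λ s → disjointOfSize 0 (false ∷ x) H (true ∷ s)) (λ _ → refl)))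

Σdisjoint-false∷-suc : ∀ n c (x : Subset n) H →
  Σdisjoint (suc n) (suc c) (false ∷ x) H ≡ Σdisjoint n c x (λ s → H (true ∷ s)) + Σdisjoint n (suc c) x (λ s → H (false ∷ s))
Σdisjoint-false∷-suc n c x H = Σsubsets-suc n _

Σdisjoint-empty : ∀ n c (x : Subset n) H → n < c + ∣ x ∣ → Σdisjoint n c x H ≡ 0
Σdisjoint-empty zero    (suc c) []          H _  = refl
Σdisjoint-empty (suc n) c       (true ∷ x)  H lt =
  trans (Σdisjoint-true∷ n c x H) (Σdisjoint-empty n c x _ (≤-pred (≤-trans lt (≤-reflexive (+-suc c ∣ x ∣)))))
Σdisjoint-empty (suc n) zero    (false ∷ x) H lt =
  trans (Σdisjoint-false∷-zero n x H) (Σdisjoint-empty n 0 x _ (<-trans (n<1+n n) lt))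
Σdisjoint-empty (suc n) (suc c) (false ∷ x) H lt =
  trans (Σdisjoint-false∷-suc n c x H)
        (cong₂ _+_ (Σdisjoint-empty n c x _ (≤-pred lt)) (Σdisjoint-empty n (suc c) x _ (<-trans (n<1+n n) lt)))

Σdisjoint-∁ : ∀ n c (x : Subset n) H → c + ∣ x ∣ ≡ n → Σdisjoint n c x H ≡ H (∁ x)
Σdisjoint-∁ zero    zero    []          H _  = trans (+-identityʳ _) (*-identityˡ (H []))
Σdisjoint-∁ (suc n) c       (true ∷ x)  H eq =
  trans (Σdisjoint-true∷ n c x H) (Σdisjoint-∁ n c x _ (suc-injective (trans (sym (+-suc c ∣ x ∣)) eq)))
Σdisjoint-∁ (suc n) zero    (false ∷ x) H eq = ⊥-elim (<-irrefl eq (s≤s (∣p∣≤n x)))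
Σdisjoint-∁ (suc n) (suc c) (false ∷ x) H eq =
  trans (Σdisjoint-false∷-suc n c x H)
        (trans (cong₂ _+_ (Σdisjoint-∁ n c x _ (suc-injective eq)) (Σdisjoint-empty n (suc c) x _ (≤-reflexive (sym eq))))
               (+-identityʳ _))

Σdisjoint-neighbours : ∀ n c (x : Subset n) H → suc (c + ∣ x ∣) ≡ n → Σdisjoint n c x H ≡ Σneighbours x H
Σdisjoint-neighbours (suc n) c       (true ∷ x)  H eq =
  trans (Σdisjoint-true∷ n c x H) (Σdisjoint-neighbours n c x _ (suc-injective (trans (cong suc (sym (+-suc c ∣ x ∣))) eq)))
Σdisjoint-neighbours (suc n) zero    (false ∷ x) H eq =
  trans (Σdisjoint-false∷-zero n x H)
        (trans (Σdisjoint-∁ n 0 x _ (suc-injective eq))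
               (sym (trans (cong (H (false ∷ ∁ x) +_) (Σneighbours-full x _ (suc-injective eq))) (+-identityʳ _))))
Σdisjoint-neighbours (suc n) (suc c) (false ∷ x) H eq =
  trans (Σdisjoint-false∷-suc n c x H)
        (trans (cong₂ _+_ (Σdisjoint-neighbours n c x _ (suc-injective eq)) (Σdisjoint-∁ n (suc c) x _ (suc-injective eq)))
               (+-comm (Σneighbours x (λ s → H (true ∷ s))) _))

-- Venn regions

sel : ∀ {n} → Bool → Subset n → Subset n
sel true  p = p
sel false p = ∁ p

-- c is intersected first, so that a point outside sel w c is discarded without inspecting a and b
region : ∀ {n} (a b c : Subset n) → Bool → Bool → Bool → ℕ
region a b c u v w = ∣ sel w c ∩ sel u a ∩ sel v b ∣

∣p∣≡∣p∩q∣+∣p∩∁q∣ : ∀ {n} (p q : Subset n) → ∣ p ∣ ≡ ∣ p ∩ q ∣ + ∣ p ∩ ∁ q ∣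
∣p∣≡∣p∩q∣+∣p∩∁q∣ []          []          = refl
∣p∣≡∣p∩q∣+∣p∩∁q∣ (true ∷ p)  (true ∷ q)  = cong suc (∣p∣≡∣p∩q∣+∣p∩∁q∣ p q)
∣p∣≡∣p∩q∣+∣p∩∁q∣ (true ∷ p)  (false ∷ q) = trans (cong suc (∣p∣≡∣p∩q∣+∣p∩∁q∣ p q)) (sym (+-suc _ _))
∣p∣≡∣p∩q∣+∣p∩∁q∣ (false ∷ p) (_ ∷ q)     = ∣p∣≡∣p∩q∣+∣p∩∁q∣ p q

∣p∩q∣≡∣q∩p∣ : ∀ {n} (p q : Subset n) → ∣ p ∩ q ∣ ≡ ∣ q ∩ p ∣
∣p∩q∣≡∣q∩p∣ p q = cong ∣_∣ (∩-comm p q)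

module _ {n} (a b c : Subset n) where
  private R = region a b c

  ∣a∩c∣ : ∣ a ∩ c ∣ ≡ R true true true + R true false true
  ∣a∩c∣ = begin
    ∣ a ∩ c ∣                              ≡⟨ ∣p∩q∣≡∣q∩p∣ a c ⟩
    ∣ c ∩ a ∣                              ≡⟨ ∣p∣≡∣p∩q∣+∣p∩∁q∣ (c ∩ a) b ⟩
    ∣ (c ∩ a) ∩ b ∣ + ∣ (c ∩ a) ∩ ∁ b ∣    ≡⟨ cong₂ _+_ (cong ∣_∣ (∩-assoc c a b)) (cong ∣_∣ (∩-assoc c a (∁ b))) ⟩
    R true true true + R true false true   ∎
    where open ≡-Reasoning

  ∣a∩b∣ : ∣ a ∩ b ∣ ≡ R true true true + R true true false
  ∣a∩b∣ = trans (∣p∣≡∣p∩q∣+∣p∩∁q∣ (a ∩ b) c) (cong₂ _+_ (∣p∩q∣≡∣q∩p∣ (a ∩ b) c) (∣p∩q∣≡∣q∩p∣ (a ∩ b) (∁ c)))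

  ∣c∩b∣ : ∣ c ∩ b ∣ ≡ R true true true + R false true true
  ∣c∩b∣ = trans (∣p∣≡∣p∩q∣+∣p∩∁q∣ (c ∩ b) a) (cong₂ _+_ (cong ∣_∣ (reorder a)) (cong ∣_∣ (reorder (∁ a))))
    where reorder : ∀ a′ → (c ∩ b) ∩ a′ ≡ c ∩ a′ ∩ b
          reorder a′ = trans (∩-assoc c b a′) (cong (c ∩_) (∩-comm b a′))

  ∣a∩c∩b∣ : ∣ a ∩ c ∩ b ∣ ≡ R true true true
  ∣a∩c∩b∣ = cong ∣_∣ (begin
    a ∩ c ∩ b     ≡⟨ ∩-assoc a c b ⟨
    (a ∩ c) ∩ b   ≡⟨ cong (_∩ b) (∩-comm a c) ⟩
    (c ∩ a) ∩ b   ≡⟨ ∩-assoc c a b ⟩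
    c ∩ a ∩ b     ∎)
    where open ≡-Reasoning

module _ {n} (a b c : Subset n) where
  private R = region a b c

  ∣a∣ : ∣ a ∣ ≡ (R true true true + R true false true) + (R true true false + R true false false)
  ∣a∣ = trans (∣p∣≡∣p∩q∣+∣p∩∁q∣ a c) (cong₂ _+_ (∣a∩c∣ a b c) (∣a∩c∣ a b (∁ c)))

  ∣b∣ : ∣ b ∣ ≡ (R true true true + R false true true) + (R true true false + R false true false)
  ∣b∣ = trans (∣p∣≡∣p∩q∣+∣p∩∁q∣ b c)
              (cong₂ _+_ (trans (∣p∩q∣≡∣q∩p∣ b c) (∣c∩b∣ a b c)) (trans (∣p∩q∣≡∣q∩p∣ b (∁ c)) (∣c∩b∣ a b (∁ c))))

  ∣c∣ : ∣ c ∣ ≡ (R true true true + R true false true) + (R false true true + R false false true)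
  ∣c∣ = trans (∣p∣≡∣p∩q∣+∣p∩∁q∣ c a)
              (cong₂ _+_ (trans (∣p∩q∣≡∣q∩p∣ c a) (∣a∩c∣ a b c)) (trans (∣p∩q∣≡∣q∩p∣ c (∁ a)) (∣a∩c∣ (∁ a) b c)))

-- pred 0 is harmless here: it is weighted by 0
_⊛_ : ℕ → (ℕ → ℕ) → ℕ
d ⊛ g = d * g (pred d)

⊛-suc : ∀ d g → suc d ⊛ g ≡ g d + d ⊛ (λ z → g (suc z))
⊛-suc zero    g = refl
⊛-suc (suc d) g = refl

Σtypes : ℕ → ℕ → ℕ → ℕ → (ℕ → ℕ → ℕ → ℕ → ℕ) → ℕ
Σtypes d₁₁ d₁₀ d₀₁ d₀₀ G =
  d₁₁ ⊛ (λ z → G z d₁₀ d₀₁ d₀₀) + d₁₀ ⊛ (λ z → G d₁₁ z d₀₁ d₀₀) + d₀₁ ⊛ (λ z → G d₁₁ d₁₀ z d₀₀) + d₀₀ ⊛ G d₁₁ d₁₀ d₀₁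

module _ (d₁₁ d₁₀ d₀₁ d₀₀ : ℕ) (G : ℕ → ℕ → ℕ → ℕ → ℕ) where

  Σtypes-suc₁₁ : Σtypes (suc d₁₁) d₁₀ d₀₁ d₀₀ G ≡ G d₁₁ d₁₀ d₀₁ d₀₀ + Σtypes d₁₁ d₁₀ d₀₁ d₀₀ (λ p → G (suc p))
  Σtypes-suc₁₁ = trans (cong (λ t → t + T₁₀ + T₀₁ + T₀₀) (⊛-suc d₁₁ (λ z → G z d₁₀ d₀₁ d₀₀))) (shuffle (G d₁₁ d₁₀ d₀₁ d₀₀) _ T₁₀ T₀₁ T₀₀)
    where T₁₀ = d₁₀ ⊛ (λ z → G (suc d₁₁) z d₀₁ d₀₀)
          T₀₁ = d₀₁ ⊛ (λ z → G (suc d₁₁) d₁₀ z d₀₀)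
          T₀₀ = d₀₀ ⊛ G (suc d₁₁) d₁₀ d₀₁
          shuffle : ∀ x y p q r → x + y + p + q + r ≡ x + (y + p + q + r)
          shuffle = solve-∀

  Σtypes-suc₁₀ : Σtypes d₁₁ (suc d₁₀) d₀₁ d₀₀ G ≡ G d₁₁ d₁₀ d₀₁ d₀₀ + Σtypes d₁₁ d₁₀ d₀₁ d₀₀ (λ p q → G p (suc q))
  Σtypes-suc₁₀ = trans (cong (λ t → T₁₁ + t + T₀₁ + T₀₀) (⊛-suc d₁₀ (λ z → G d₁₁ z d₀₁ d₀₀))) (shuffle (G d₁₁ d₁₀ d₀₁ d₀₀) _ T₁₁ T₀₁ T₀₀)
    where T₁₁ = d₁₁ ⊛ (λ z → G z (suc d₁₀) d₀₁ d₀₀)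
          T₀₁ = d₀₁ ⊛ (λ z → G d₁₁ (suc d₁₀) z d₀₀)
          T₀₀ = d₀₀ ⊛ G d₁₁ (suc d₁₀) d₀₁
          shuffle : ∀ x y p q r → p + (x + y) + q + r ≡ x + (p + y + q + r)
          shuffle = solve-∀

  Σtypes-suc₀₁ : Σtypes d₁₁ d₁₀ (suc d₀₁) d₀₀ G ≡ G d₁₁ d₁₀ d₀₁ d₀₀ + Σtypes d₁₁ d₁₀ d₀₁ d₀₀ (λ p q r → G p q (suc r))
  Σtypes-suc₀₁ = trans (cong (λ t → T₁₁ + T₁₀ + t + T₀₀) (⊛-suc d₀₁ (λ z → G d₁₁ d₁₀ z d₀₀))) (shuffle (G d₁₁ d₁₀ d₀₁ d₀₀) _ T₁₁ T₁₀ T₀₀)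
    where T₁₁ = d₁₁ ⊛ (λ z → G z d₁₀ (suc d₀₁) d₀₀)
          T₁₀ = d₁₀ ⊛ (λ z → G d₁₁ z (suc d₀₁) d₀₀)
          T₀₀ = d₀₀ ⊛ G d₁₁ d₁₀ (suc d₀₁)
          shuffle : ∀ x y p q r → p + q + (x + y) + r ≡ x + (p + q + y + r)
          shuffle = solve-∀

  Σtypes-suc₀₀ : Σtypes d₁₁ d₁₀ d₀₁ (suc d₀₀) G ≡ G d₁₁ d₁₀ d₀₁ d₀₀ + Σtypes d₁₁ d₁₀ d₀₁ d₀₀ (λ p q r s → G p q r (suc s))
  Σtypes-suc₀₀ = trans (cong (λ t → T₁₁ + T₁₀ + T₀₁ + t) (⊛-suc d₀₀ (G d₁₁ d₁₀ d₀₁))) (shuffle (G d₁₁ d₁₀ d₀₁ d₀₀) _ T₁₁ T₁₀ T₀₁)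
    where T₁₁ = d₁₁ ⊛ (λ z → G z d₁₀ d₀₁ (suc d₀₀))
          T₁₀ = d₁₀ ⊛ (λ z → G d₁₁ z d₀₁ (suc d₀₀))
          T₀₁ = d₀₁ ⊛ (λ z → G d₁₁ d₁₀ z (suc d₀₀))
          shuffle : ∀ x y p q r → p + q + r + (x + y) ≡ x + (p + q + r + y)
          shuffle = solve-∀

-- G at the numbers of points of c in x₀ ∩ y, x₀ ∖ y, y ∖ x₀ and outside both
atTypes : ∀ {n} (x₀ y c : Subset n) → (ℕ → ℕ → ℕ → ℕ → ℕ) → ℕ
atTypes x₀ y c G = G (region x₀ y c true true true) (region x₀ y c true false true)
                     (region x₀ y c false true true) (region x₀ y c false false true)

Σtypes-of : ∀ {n} (x₀ y c : Subset n) → (ℕ → ℕ → ℕ → ℕ → ℕ) → ℕ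
Σtypes-of x₀ y c = Σtypes (region x₀ y c true true true) (region x₀ y c true false true)
                          (region x₀ y c false true true) (region x₀ y c false false true)

Σneighbours-by-type : ∀ {n} (x₀ y x : Subset n) G →
  Σneighbours x (λ w → atTypes x₀ y w G) ≡ Σtypes-of x₀ y (∁ x) G
Σneighbours-by-type []            []           []          G = refl
Σneighbours-by-type (_ ∷ x₀)      (_ ∷ y)      (true ∷ x)  G = Σneighbours-by-type x₀ y x G
Σneighbours-by-type (true ∷ x₀)   (true ∷ y)   (false ∷ x) G =
  trans (cong (atTypes x₀ y (∁ x) G +_) (Σneighbours-by-type x₀ y x (λ p → G (suc p))))
        (sym (Σtypes-suc₁₁ _ _ _ _ G))
Σneighbours-by-type (true ∷ x₀)   (false ∷ y)  (false ∷ x) G =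
  trans (cong (atTypes x₀ y (∁ x) G +_) (Σneighbours-by-type x₀ y x (λ p q → G p (suc q))))
        (sym (Σtypes-suc₁₀ _ _ _ _ G))
Σneighbours-by-type (false ∷ x₀)  (true ∷ y)   (false ∷ x) G =
  trans (cong (atTypes x₀ y (∁ x) G +_) (Σneighbours-by-type x₀ y x (λ p q r → G p q (suc r))))
        (sym (Σtypes-suc₀₁ _ _ _ _ G))
Σneighbours-by-type (false ∷ x₀)  (false ∷ y)  (false ∷ x) G =
  trans (cong (atTypes x₀ y (∁ x) G +_) (Σneighbours-by-type x₀ y x (λ p q r s → G p q r (suc s))))
        (sym (Σtypes-suc₀₀ _ _ _ _ G))

-- Profiles of neighbours

Profile : Set
Profile = ℕ × ℕ × ℕ × ℕ

_≐_ : Profile → Profile → Set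
(α , β , τ , π) ≐ (a , b , t , p) = α ≡ a × β ≡ b × τ ≡ t × π ≡ p

_≐?_ : (P Q : Profile) → Dec (P ≐ Q)
(α , β , τ , π) ≐? (a , b , t , p) = α ≟ a ×-dec β ≟ b ×-dec τ ≟ t ×-dec π ≟ p

-- M m a b t p x y is 𝟙 (profile m x y ≐? (a , b , t , p)) by definition
profile : (m : ℕ) → Sub m → Sub m → Profile
profile m x y = ∣ x₀ m ∩ x ∣ , ∣ x₀ m ∩ y ∣ , ∣ x ∩ y ∣ , ∣ x₀ m ∩ x ∩ y ∣

-- the profile of a set with c₁₁, c₁₀, c₀₁ points in x₀ ∩ y, x₀ ∖ y, y ∖ x₀, when |x₀ ∩ y| = β
typeProfile : ℕ → ℕ → ℕ → ℕ → Profile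
typeProfile β c₁₁ c₁₀ c₀₁ = c₁₁ + c₁₀ , β , c₁₁ + c₀₁ , c₁₁

-- how many sets ∁ x ∖ {j} have profile P, when ∁ x has type counts d₁₁ d₁₀ d₀₁ d₀₀
neighbourCount : ℕ → ℕ → ℕ → ℕ → ℕ → Profile → ℕ
neighbourCount β d₁₁ d₁₀ d₀₁ d₀₀ (a , b , t , p) =
    d₁₁ * 𝟙 (o ≐? (suc a , b , suc t , suc p)) + d₁₀ * 𝟙 (o ≐? (suc a , b , t , p))
  + d₀₁ * 𝟙 (o ≐? (a , b , suc t , p))       + d₀₀ * 𝟙 (o ≐? (a , b , t , p))
  where o = typeProfile β d₁₁ d₁₀ d₀₁

⊛-shift : ∀ d (g f : ℕ → ℕ) → (∀ z → g z ≡ f (suc z)) → d ⊛ g ≡ d * f d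
⊛-shift zero    g f eq = refl
⊛-shift (suc d) g f eq = cong (suc d *_) (eq d)

Σtypes-profile : ∀ β d₁₁ d₁₀ d₀₁ d₀₀ P →
  Σtypes d₁₁ d₁₀ d₀₁ d₀₀ (λ c₁₁ c₁₀ c₀₁ _ → 𝟙 (typeProfile β c₁₁ c₁₀ c₀₁ ≐? P)) ≡ neighbourCount β d₁₁ d₁₀ d₀₁ d₀₀ P
Σtypes-profile β A C E G (a , b , t , p) =
  cong₂ _+_ (cong₂ _+_ (cong₂ _+_ (⊛-shift A _ (λ c → test (c + C , β , c + E , c) (suc a , b , suc t , suc p)) (λ _ → refl))
                                  (⊛-shift C _ (λ c → test (A + c , β , A + E , A) (suc a , b , t , p)) shiftα))
                       (⊛-shift E _ (λ c → test (A + C , β , A + c , A) (a , b , suc t , p)) shiftτ))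
            refl
  where
  test : Profile → Profile → ℕ
  test P Q = 𝟙 (P ≐? Q)
  shiftα : ∀ z → test (A + z , β , A + E , A) (a , b , t , p) ≡ test (A + suc z , β , A + E , A) (suc a , b , t , p)
  shiftα z = cong (λ α → test (α , β , A + E , A) (suc a , b , t , p)) (sym (+-suc A z))
  shiftτ : ∀ z → test (A + C , β , A + z , A) (a , b , t , p) ≡ test (A + C , β , A + suc z , A) (a , b , suc t , p)
  shiftτ z = cong (λ τ → test (A + C , β , τ , A) (a , b , suc t , p)) (sym (+-suc A z))

-- n_uvw counts the points whose memberships in x₀, y, x are u, v, w
record Venn (m : ℕ) : Set where
  field
    n111 n110 n101 n100 n011 n010 n001 n000 : ℕ
    size-x₀  : (n111 + n101) + (n110 + n100) ≡ m
    size-y   : (n111 + n011) + (n110 + n010) ≡ m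
    size-x   : (n111 + n101) + (n011 + n001) ≡ m
    size-∁x₀ : (n011 + n001) + (n010 + n000) ≡ suc m

  profileᵛ : Profile
  profileᵛ = typeProfile (n111 + n110) n111 n101 n011

  countᵛ : Profile → ℕ
  countᵛ = neighbourCount (n111 + n110) n110 n100 n010 n000

open Venn using (profileᵛ; countᵛ)

∣x₀∣≡m : ∀ m → ∣ x₀ m ∣ ≡ m
∣x₀∣≡m m = ∣first∣ (Ground m) m (≤-trans (m≤m+n m (m + 0)) (n≤1+n _))
  where
  ∣first∣ : ∀ n k → k ≤ n → ∣ tabulate {n = n} (λ j → toℕ j <ᵇ k) ∣ ≡ k
  ∣first∣ zero    zero    _         = refl
  ∣first∣ (suc n) zero    _         = ∣first∣ n zero z≤n
  ∣first∣ (suc n) (suc k) (s≤s k≤n) = cong suc (∣first∣ n k k≤n)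

∣∁x₀∣≡1+m : ∀ m → ∣ ∁ (x₀ m) ∣ ≡ suc m
∣∁x₀∣≡1+m m = begin
  ∣ ∁ (x₀ m) ∣          ≡⟨ ∣∁p∣≡n∸∣p∣ (x₀ m) ⟩
  Ground m ∸ ∣ x₀ m ∣   ≡⟨ cong₂ _∸_ (ground m) (∣x₀∣≡m m) ⟩
  m + suc m ∸ m         ≡⟨ m+n∸m≡n m (suc m) ⟩
  suc m                 ∎
  where open ≡-Reasoning
        ground : ∀ m → suc (2 * m) ≡ m + suc m
        ground = solve-∀

venn : ∀ m (y x : Sub m) → ∣ y ∣ ≡ m → ∣ x ∣ ≡ m → Venn m
venn m y x ∣y∣≡m ∣x∣≡m = record
  { n111 = R true true true   ; n110 = R true true false   ; n101 = R true false true   ; n100 = R true false false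
  ; n011 = R false true true  ; n010 = R false true false  ; n001 = R false false true  ; n000 = R false false false
  ; size-x₀  = trans (sym (∣a∣ (x₀ m) y x)) (∣x₀∣≡m m)
  ; size-y   = trans (sym (∣b∣ (x₀ m) y x)) ∣y∣≡m
  ; size-x   = trans (sym (∣c∣ (x₀ m) y x)) ∣x∣≡m
  ; size-∁x₀ = trans (sym (∣a∣ (∁ (x₀ m)) y x)) (∣∁x₀∣≡1+m m)
  }
  where R = region (x₀ m) y x

profile-by-types : ∀ m (y x w : Sub m) → let R = region (x₀ m) y x ; Rʷ = region (x₀ m) y w in
  profile m w y ≡ typeProfile (R true true true + R true true false) (Rʷ true true true) (Rʷ true false true) (Rʷ false true true)
profile-by-types m y x w =
  cong₂ _,_ (∣a∩c∣ (x₀ m) y w) (cong₂ _,_ (∣a∩b∣ (x₀ m) y x) (cong₂ _,_ (∣c∩b∣ (x₀ m) y w) (∣a∩c∩b∣ (x₀ m) y w)))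

Σneighbours-M : ∀ m (y x : Sub m) (∣y∣≡m : ∣ y ∣ ≡ m) (∣x∣≡m : ∣ x ∣ ≡ m) P →
  Σneighbours x (λ w → 𝟙 (profile m w y ≐? P)) ≡ countᵛ (venn m y x ∣y∣≡m ∣x∣≡m) P
Σneighbours-M m y x ∣y∣≡m ∣x∣≡m P = begin
  Σneighbours x (λ w → 𝟙 (profile m w y ≐? P))
    ≡⟨ Σneighbours-cong x (λ w → cong (λ Q → 𝟙 (Q ≐? P)) (profile-by-types m y x w)) ⟩
  Σneighbours x (λ w → atTypes (x₀ m) y w G)
    ≡⟨ Σneighbours-by-type (x₀ m) y x G ⟩
  Σtypes-of (x₀ m) y (∁ x) G
    ≡⟨ Σtypes-profile β (R true true false) (R true false false) (R false true false) (R false false false) P ⟩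
  countᵛ (venn m y x ∣y∣≡m ∣x∣≡m) P ∎
  where
  open ≡-Reasoning
  R = region (x₀ m) y x
  β = R true true true + R true true false
  G : ℕ → ℕ → ℕ → ℕ → ℕ
  G c₁₁ c₁₀ c₀₁ _ = 𝟙 (typeProfile β c₁₁ c₁₀ c₀₁ ≐? P)

-- One step of the chain

mul-congʳ : ∀ m (A : Mat m) {P F : Mat m} → MatEq m P F → ∀ x y → ∣ y ∣ ≡ m → mul m A P x y ≡ mul m A F x y
mul-congʳ m A P≈F x y ∣y∣≡m =
  cong sum (map-cong-local (All.map (λ {z} ∣z∣≡m → cong (A x z *_) (P≈F z y ∣z∣≡m ∣y∣≡m))
                                    (all-filter (λ s → ∣ s ∣ ≟ m) (allSubsets (Ground m)))))

E*-mul : ∀ m j (Q : Mat m) x y → ∣ x ∣ ≡ m →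
  mul m (E* m j) Q x y ≡ (if dist m (x₀ m) x ≡ᵇ j then 1 else 0) * Q x y
E*-mul m j Q x y ∣x∣≡m = begin
  mul m (E* m j) Q x y
    ≡⟨ sum-map-filter (λ s → ∣ s ∣ ≟ m) (λ z → E* m j x z * Q z y) (allSubsets (Ground m)) ⟩
  Σsubsets (Ground m) term
    ≡⟨ Σsubsets-point (Ground m) x term off-diagonal ⟩
  term x
    ≡⟨ cong (λ b → if b then E* m j x x * Q x y else 0) (dec-true (∣ x ∣ ≟ m) ∣x∣≡m) ⟩
  E* m j x x * Q x y
    ≡⟨ cong (λ b → (if b ∧ (dist m (x₀ m) x ≡ᵇ j) then 1 else 0) * Q x y) (dec-true (≡-dec Bool._≟_ x x) refl) ⟩
  (if dist m (x₀ m) x ≡ᵇ j then 1 else 0) * Q x y ∎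
  where
  open ≡-Reasoning
  term : Sub m → ℕ
  term z = if does (∣ z ∣ ≟ m) then E* m j x z * Q z y else 0
  off-diagonal : ∀ z → z ≢ x → term z ≡ 0
  off-diagonal z z≢x rewrite dec-false (≡-dec Bool._≟_ x z) (z≢x ∘ sym) = if-const (does (∣ z ∣ ≟ m))

A₁-mul : ∀ m (F : Mat m) x y → ∣ x ∣ ≡ m → mul m (A₁ m) F x y ≡ Σneighbours x (λ w → F w y)
A₁-mul m F x y ∣x∣≡m =
  trans (sum-map-filter (λ s → ∣ s ∣ ≟ m) (λ z → A₁ m x z * F z y) (allSubsets (Ground m)))
        (Σdisjoint-neighbours (Ground m) m x (λ w → F w y) (cong suc (trans (cong (m +_) ∣x∣≡m) (cong (m +_) (sym (+-identityʳ m))))))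

chain-step : ∀ m i k c s {a b t p a′ b′ t′ p′} →
  MatEq m (Pchain m i k) (scale m c (M m a b t p)) →
  (∀ x → ∣ x ∣ ≡ m → (dist m (x₀ m) x ≡ᵇ i + suc k) ≡ (∣ x₀ m ∩ x ∣ ≡ᵇ a′)) →
  (∀ (V : Venn m) → Venn.n111 V + Venn.n101 V ≡ a′ → countᵛ V (a , b , t , p) ≡ suc s * 𝟙 (profileᵛ V ≐? (a′ , b′ , t′ , p′))) →
  MatEq m (Pchain m i (suc k)) (scale m (c * suc s) (M m a′ b′ t′ p′))
chain-step m i k c s {a} {b} {t} {p} {a′} {b′} {t′} {p′} Pₖ row count x y ∣x∣≡m ∣y∣≡m = begin
  Pchain m i (suc k) x y
    ≡⟨ E*-mul m (i + suc k) (mul m (A₁ m) (Pchain m i k)) x y ∣x∣≡m ⟩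
  (if dist m (x₀ m) x ≡ᵇ i + suc k then 1 else 0) * mul m (A₁ m) (Pchain m i k) x y
    ≡⟨ cong₂ (λ b n → (if b then 1 else 0) * n) (row x ∣x∣≡m) (mul-congʳ m (A₁ m) Pₖ x y ∣y∣≡m) ⟩
  𝟙 (α ≟ a′) * mul m (A₁ m) (scale m c (M m a b t p)) x y
    ≡⟨ cong (𝟙 (α ≟ a′) *_) (trans (A₁-mul m (scale m c (M m a b t p)) x y ∣x∣≡m) (Σneighbours-* x c (λ w → M m a b t p w y))) ⟩
  𝟙 (α ≟ a′) * (c * Σneighbours x (λ w → M m a b t p w y))
    ≡⟨ cong (λ n → 𝟙 (α ≟ a′) * (c * n)) (Σneighbours-M m y x ∣y∣≡m ∣x∣≡m (a , b , t , p)) ⟩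
  𝟙 (α ≟ a′) * (c * countᵛ V (a , b , t , p))
    ≡⟨ guarded (α ≟ a′) ⟩
  c * suc s * M m a′ b′ t′ p′ x y ∎
  where
  open ≡-Reasoning
  α = ∣ x₀ m ∩ x ∣
  V = venn m y x ∣y∣≡m ∣x∣≡m
  P′ = (a′ , b′ , t′ , p′)
  guarded : (α? : Dec (α ≡ a′)) → 𝟙 α? * (c * countᵛ V (a , b , t , p)) ≡ c * suc s * 𝟙 (profile m x y ≐? P′)
  guarded (yes α≡a′) = begin
    1 * (c * countᵛ V (a , b , t , p))
      ≡⟨ *-identityˡ _ ⟩
    c * countᵛ V (a , b , t , p)
      ≡⟨ cong (c *_) (count V (trans (sym (∣a∩c∣ (x₀ m) y x)) α≡a′)) ⟩
    c * (suc s * 𝟙 (profileᵛ V ≐? P′))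
      ≡⟨ *-assoc c (suc s) _ ⟨
    c * suc s * 𝟙 (profileᵛ V ≐? P′)
      ≡⟨ cong (λ Q → c * suc s * 𝟙 (Q ≐? P′)) (profile-by-types m y x x) ⟨
    c * suc s * 𝟙 (profile m x y ≐? P′) ∎
  guarded (no α≢a′) = sym (trans (cong (c * suc s *_) (𝟙-no (profile m x y ≐? P′) (λ (α≡a′ , _) → α≢a′ α≡a′))) (*-zeroʳ (c * suc s)))

∣p∩q∣≡∣p∣≡∣q∣⇒p≡q : ∀ {n} (x y : Subset n) → ∣ x ∩ y ∣ ≡ ∣ x ∣ → ∣ x ∩ y ∣ ≡ ∣ y ∣ → x ≡ y
∣p∩q∣≡∣p∣≡∣q∣⇒p≡q []          []          _   _   = refl
∣p∩q∣≡∣p∣≡∣q∣⇒p≡q (true ∷ x)  (true ∷ y)  eqˣ eqʸ = cong (true ∷_) (∣p∩q∣≡∣p∣≡∣q∣⇒p≡q x y (suc-injective eqˣ) (suc-injective eqʸ))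
∣p∩q∣≡∣p∣≡∣q∣⇒p≡q (false ∷ x) (false ∷ y) eqˣ eqʸ = cong (false ∷_) (∣p∩q∣≡∣p∣≡∣q∣⇒p≡q x y eqˣ eqʸ)
∣p∩q∣≡∣p∣≡∣q∣⇒p≡q (true ∷ x)  (false ∷ y) eqˣ _   = ⊥-elim (<-irrefl eqˣ (s≤s (∣p∩q∣≤∣p∣ x y)))
∣p∩q∣≡∣p∣≡∣q∣⇒p≡q (false ∷ x) (true ∷ y)  _   eqʸ = ⊥-elim (<-irrefl eqʸ (s≤s (∣p∩q∣≤∣q∣ x y)))

E*-as-M : ∀ m i α → (∀ y → ∣ y ∣ ≡ m → (dist m (x₀ m) y ≡ᵇ i) ≡ (∣ x₀ m ∩ y ∣ ≡ᵇ α)) →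
  MatEq m (Pchain m i 0) (scale m 1 (M m α α m α))
E*-as-M m i α row x y ∣x∣≡m ∣y∣≡m with ≡-dec Bool._≟_ x y
... | yes refl = begin
  (if dist m (x₀ m) x ≡ᵇ i then 1 else 0)    ≡⟨ cong (λ b → if b then 1 else 0) (row x ∣x∣≡m) ⟩
  𝟙 (∣ x₀ m ∩ x ∣ ≟ α)                       ≡⟨ 𝟙-⇔ (∣ x₀ m ∩ x ∣ ≟ α) (profile m x x ≐? (α , α , m , α)) diagonal proj₁ ⟩
  𝟙 (profile m x x ≐? (α , α , m , α))       ≡⟨ *-identityˡ _ ⟨
  1 * M m α α m α x x                         ∎
  where
  open ≡-Reasoning
  diagonal : ∣ x₀ m ∩ x ∣ ≡ α → profile m x x ≐ (α , α , m , α)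
  diagonal eq = eq , eq , trans (cong ∣_∣ (∩-idem x)) ∣x∣≡m , trans (cong (λ z → ∣ x₀ m ∩ z ∣) (∩-idem x)) eq
... | no x≢y = sym (trans (*-identityˡ _) (𝟙-no (profile m x y ≐? (α , α , m , α))
                   (λ (_ , _ , ∣x∩y∣≡m , _) → x≢y (∣p∩q∣≡∣p∣≡∣q∣⇒p≡q x y (trans ∣x∩y∣≡m (sym ∣x∣≡m)) (trans ∣x∩y∣≡m (sym ∣y∣≡m))))))

-- Distance from x₀

≤⌊m∸1/2⌋⇒2*t<m : ∀ m t → 1 ≤ m → t ≤ ⌊ m ∸ 1 /2⌋ → 2 * t < m
≤⌊m∸1/2⌋⇒2*t<m (suc m) t _ t≤h = s≤s (begin
  2 * t                   ≡⟨ cong (t +_) (+-identityʳ t) ⟩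
  t + t                   ≤⟨ +-mono-≤ t≤h (≤-trans t≤h (⌊n/2⌋≤⌈n/2⌉ m)) ⟩
  ⌊ m /2⌋ + ⌈ m /2⌉       ≡⟨ ⌊n/2⌋+⌈n/2⌉≡n m ⟩
  m                       ∎)
  where open ≤-Reasoning

2*t<m⇒≤⌊m∸1/2⌋ : ∀ m t → 2 * t < m → t ≤ ⌊ m ∸ 1 /2⌋
2*t<m⇒≤⌊m∸1/2⌋ (suc m) t (s≤s 2t≤m) = begin
  t                 ≡⟨ n≡⌊n+n/2⌋ t ⟩
  ⌊ t + t /2⌋       ≤⟨ ⌊n/2⌋-mono (≤-trans (≤-reflexive (cong (t +_) (sym (+-identityʳ t)))) 2t≤m) ⟩
  ⌊ m /2⌋           ∎
  where open ≤-Reasoning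

distance : ℕ → ℕ → ℕ
distance m t = if t ≤ᵇ ⌊ m ∸ 1 /2⌋ then 2 * t + 1 else 2 * m ∸ 2 * t

distance-odd : ∀ m t a → 2 * a + 1 ≤ m → (distance m t ≡ᵇ 2 * a + 1) ≡ (t ≡ᵇ a)
distance-odd m t a 2a+1≤m with t ≤ᵇ ⌊ m ∸ 1 /2⌋ in branch
... | true  = does-⇔ (mk⇔ (λ eq → *-cancelˡ-≡ t a 2 (+-cancelʳ-≡ 1 _ _ eq)) (cong (λ t → 2 * t + 1)))
                     (2 * t + 1 ≟ 2 * a + 1) (t ≟ a)
... | false = does-⇔ (mk⇔ (λ eq → ⊥-elim (even≢odd (m ∸ t) a (trans (*-distribˡ-∸ 2 m t) (trans eq (+-comm _ 1)))))
                          (λ t≡a → ⊥-elim (subst T branch (≤⇒≤ᵇ (2*t<m⇒≤⌊m∸1/2⌋ m t (subst (λ t → 2 * t < m) (sym t≡a) 2a<m))))))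
                     (2 * m ∸ 2 * t ≟ 2 * a + 1) (t ≟ a)
  where
  2a<m : 2 * a < m
  2a<m = subst (_≤ m) (+-comm (2 * a) 1) 2a+1≤m

distance-even : ∀ m t e E → 1 ≤ m → E + e ≡ m → 2 * e ≤ m → t ≤ m → (distance m t ≡ᵇ 2 * e) ≡ (t ≡ᵇ E)
distance-even m t e E 1≤m E+e≡m 2e≤m t≤m with t ≤ᵇ ⌊ m ∸ 1 /2⌋ in branch
... | true  = does-⇔ (mk⇔ (λ eq → ⊥-elim (even≢odd e t (trans (sym eq) (+-comm _ 1))))
                          (λ t≡E → ⊥-elim (<-irrefl refl (2m<2m (subst (λ t → 2 * t < m) t≡E 2t<m)))))
                     (2 * t + 1 ≟ 2 * e) (t ≟ E)
  where
  2t<m : 2 * t < m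
  2t<m = ≤⌊m∸1/2⌋⇒2*t<m m t 1≤m (≤ᵇ⇒≤ t _ (subst T (sym branch) _))
  2m<2m : 2 * E < m → m + m < m + m
  2m<2m 2E<m = begin-strict
    m + m                   ≡⟨ cong₂ _+_ E+e≡m E+e≡m ⟨
    (E + e) + (E + e)       ≡⟨ regroup E e ⟩
    2 * E + 2 * e           <⟨ +-mono-<-≤ 2E<m 2e≤m ⟩
    m + m                   ∎
    where open ≤-Reasoning
          regroup : ∀ E e → (E + e) + (E + e) ≡ 2 * E + 2 * e
          regroup = solve-∀
... | false = does-⇔ (mk⇔ (λ eq → begin
                             t               ≡⟨ m∸[m∸n]≡n t≤m ⟨
                             m ∸ (m ∸ t)     ≡⟨ cong (m ∸_) (*-cancelˡ-≡ (m ∸ t) e 2 (trans (*-distribˡ-∸ 2 m t) eq)) ⟩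
                             m ∸ e           ≡⟨ cong (_∸ e) E+e≡m ⟨
                             E + e ∸ e       ≡⟨ m+n∸n≡m E e ⟩
                             E               ∎)
                          (λ t≡E → begin
                             2 * m ∸ 2 * t   ≡⟨ *-distribˡ-∸ 2 m t ⟨
                             2 * (m ∸ t)     ≡⟨ cong (λ t → 2 * (m ∸ t)) t≡E ⟩
                             2 * (m ∸ E)     ≡⟨ cong (λ m → 2 * (m ∸ E)) E+e≡m ⟨
                             2 * (E + e ∸ E) ≡⟨ cong (2 *_) (m+n∸m≡n E e) ⟩
                             2 * e           ∎))
                     (2 * m ∸ 2 * t ≟ 2 * e) (t ≟ E)
  where open ≡-Reasoning

+-split-cancelˡ : ∀ {x y a b n} → x + y ≡ n → x ≡ a → n ≡ a + b → y ≡ b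
+-split-cancelˡ {y = y} {a} {b} x+y≡n refl n≡a+b = +-cancelˡ-≡ a y b (trans x+y≡n n≡a+b)

+-split-cancelʳ : ∀ {x y a b n} → x + y ≡ n → y ≡ b → n ≡ a + b → x ≡ a
+-split-cancelʳ {x} {a = a} {b} x+y≡n refl n≡a+b = +-cancelʳ-≡ b x a (trans x+y≡n n≡a+b)

module _ {m} (V : Venn m) where
  open Venn V using (size-x₀; size-y; size-x; size-∁x₀)
    renaming (n111 to q; n110 to A; n101 to B; n100 to C; n011 to D; n010 to E; n001 to F; n000 to G)
  private o = typeProfile (q + A) A C E

  -- only points outside x₀ can be removed when |x₀ ∖ x| = a
  countᵛ-outside-x₀ : ∀ a b t p → A + C ≡ a →
    countᵛ V (a , b , t , p) ≡ E * 𝟙 (o ≐? (a , b , suc t , p)) + G * 𝟙 (o ≐? (a , b , t , p))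
  countᵛ-outside-x₀ a b t p A+C≡a =
    cong₂ (λ u v → u + v + E * 𝟙 (o ≐? (a , b , suc t , p)) + G * 𝟙 (o ≐? (a , b , t , p)))
          (*𝟙-no A (o ≐? (suc a , b , suc t , suc p)) (λ (eq , _) → 1+n≢n (trans (sym eq) A+C≡a)))
          (*𝟙-no C (o ≐? (suc a , b , t , p)) (λ (eq , _) → 1+n≢n (trans (sym eq) A+C≡a)))

  -- only points inside x₀ can be removed when |x₀ ∖ x| = a + 1
  countᵛ-inside-x₀ : ∀ a b t p → A + C ≡ suc a →
    countᵛ V (a , b , t , p) ≡ A * 𝟙 (o ≐? (suc a , b , suc t , suc p)) + C * 𝟙 (o ≐? (suc a , b , t , p))
  countᵛ-inside-x₀ a b t p A+C≡1+a =
    trans (cong₂ (λ u v → A * 𝟙 (o ≐? (suc a , b , suc t , suc p)) + C * 𝟙 (o ≐? (suc a , b , t , p)) + u + v)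
                 (*𝟙-no E (o ≐? (a , b , suc t , p)) (λ (eq , _) → 1+n≢n (trans (sym A+C≡1+a) eq)))
                 (*𝟙-no G (o ≐? (a , b , t , p)) (λ (eq , _) → 1+n≢n (trans (sym A+C≡1+a) eq))))
          (trans (+-identityʳ _) (+-identityʳ _))

  ∣x₀∖x∣≡ : ∀ {α k} → q + B ≡ α → m ≡ α + k → A + C ≡ k
  ∣x₀∖x∣≡ = +-split-cancelˡ size-x₀

  ∣y∖x∣≡ : ∀ {τ k} → q + D ≡ τ → m ≡ τ + k → A + E ≡ k
  ∣y∖x∣≡ = +-split-cancelˡ size-y

  ∣x∩y∣≡ : ∀ {τ k} → A + E ≡ k → m ≡ τ + k → q + D ≡ τ
  ∣x∩y∣≡ = +-split-cancelʳ size-y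

  step-even-odd : ∀ {r s e} → m ≡ r + s + e → q + B ≡ r + s →
    countᵛ V (e , s + e , r + e , e) ≡ suc s * 𝟙 (profileᵛ V ≐? (r + s , s + e , s , s))
  step-even-odd {r} {s} {e} m≡ α≡ = begin
    countᵛ V (e , s + e , r + e , e)
      ≡⟨ countᵛ-outside-x₀ e (s + e) (r + e) e (∣x₀∖x∣≡ α≡ m≡) ⟩
    E * 𝟙 (o ≐? (e , s + e , suc (r + e) , e)) + G * 𝟙 (o ≐? (e , s + e , r + e , e))
      ≡⟨ cong₂ _+_ (*𝟙-no E (o ≐? _) removing-y) (*𝟙-⇔ G s (o ≐? _) (profileᵛ V ≐? _) fwd bwd weight) ⟩
    suc s * 𝟙 (profileᵛ V ≐? (r + s , s + e , s , s)) ∎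
    where
    open ≡-Reasoning
    m≡s+[r+e] : m ≡ s + (r + e)
    m≡s+[r+e] = trans m≡ (regroup r s e)
      where regroup : ∀ r s e → r + s + e ≡ s + (r + e)
            regroup = solve-∀
    q≡s : q + A ≡ s + e → A ≡ e → q ≡ s
    q≡s qA A≡e = +-cancelʳ-≡ e q s (subst (λ A → q + A ≡ s + e) A≡e qA)
    removing-y : ¬ (o ≐ (e , s + e , suc (r + e) , e))
    removing-y (_ , qA , AE , A≡e) = m≢1+n+m (s + (r + e)) {D} (begin
      s + (r + e)           ≡⟨ trans size-y m≡s+[r+e] ⟨
      (q + D) + (A + E)     ≡⟨ cong₂ (λ q AE → (q + D) + AE) (q≡s qA A≡e) AE ⟩
      (s + D) + suc (r + e) ≡⟨ regroup s D (r + e) ⟩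
      suc (D + (s + (r + e))) ∎)
      where regroup : ∀ s D x → (s + D) + suc x ≡ suc (D + (s + x))
            regroup = solve-∀
    fwd : o ≐ (e , s + e , r + e , e) → profileᵛ V ≐ (r + s , s + e , s , s)
    fwd (_ , qA , AE , A≡e) = α≡ , qA , ∣x∩y∣≡ AE m≡s+[r+e] , q≡s qA A≡e
    bwd : profileᵛ V ≐ (r + s , s + e , s , s) → o ≐ (e , s + e , r + e , e)
    bwd (_ , qA , qD , q≡s) = ∣x₀∖x∣≡ α≡ m≡ , qA , ∣y∖x∣≡ qD m≡s+[r+e] , +-cancelˡ-≡ s A e (subst (λ q → q + A ≡ s + e) q≡s qA)
    weight : profileᵛ V ≐ (r + s , s + e , s , s) → G ≡ suc s
    weight Q with bwd Q
    ... | (_ , _ , AE , refl) = +-cancelˡ-≡ r G (suc s) (+-cancelˡ-≡ A _ _ (begin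
      A + (r + G)          ≡⟨ cong₂ (λ DF E → DF + (E + G)) D+F≡A E≡r ⟨
      (D + F) + (E + G)    ≡⟨ size-∁x₀ ⟩
      suc m                ≡⟨ cong suc m≡ ⟩
      suc (r + s + A)      ≡⟨ regroup r s A ⟩
      A + (r + suc s)      ∎))
      where
      D+F≡A : D + F ≡ A
      D+F≡A = +-split-cancelˡ size-x α≡ m≡
      E≡r : E ≡ r
      E≡r = +-cancelˡ-≡ A E r (trans AE (+-comm r A))
      regroup : ∀ r s A → suc (r + s + A) ≡ A + (r + suc s)
      regroup = solve-∀

  step-even-even : ∀ {r s e} → m ≡ r + suc s + e → q + B ≡ e →
    countᵛ V (r + s , s + suc e , s , s) ≡ suc s * 𝟙 (profileᵛ V ≐? (e , suc s + e , r + e , e))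
  step-even-even {r} {s} {e} m≡ α≡ = begin
    countᵛ V (r + s , s + suc e , s , s)
      ≡⟨ countᵛ-inside-x₀ (r + s) (s + suc e) s s A+C≡ ⟩
    A * 𝟙 (o ≐? (suc (r + s) , s + suc e , suc s , suc s)) + C * 𝟙 (o ≐? (suc (r + s) , s + suc e , s , s))
      ≡⟨ cong₂ _+_ (*𝟙-⇔ A s (o ≐? _) (profileᵛ V ≐? _) fwd bwd (λ Q → proj₂ (proj₂ (proj₂ (bwd Q)))))
                   (*𝟙-no C (o ≐? _) removing-x₀∩y) ⟩
    suc s * 𝟙 (profileᵛ V ≐? (e , suc s + e , r + e , e)) + 0
      ≡⟨ +-identityʳ _ ⟩
    suc s * 𝟙 (profileᵛ V ≐? (e , suc s + e , r + e , e)) ∎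
    where
    open ≡-Reasoning
    A+C≡ : A + C ≡ suc (r + s)
    A+C≡ = ∣x₀∖x∣≡ α≡ (trans m≡ (regroup r s e))
      where regroup : ∀ r s e → r + suc s + e ≡ e + suc (r + s)
            regroup = solve-∀
    m≡[r+e]+1+s : m ≡ (r + e) + suc s
    m≡[r+e]+1+s = trans m≡ (regroup r s e)
      where regroup : ∀ r s e → r + suc s + e ≡ (r + e) + suc s
            regroup = solve-∀
    removing-x₀∩y : ¬ (o ≐ (suc (r + s) , s + suc e , s , s))
    removing-x₀∩y (_ , qA , _ , A≡s) = m≢1+m+n e {B} (sym (trans (cong (_+ B) (sym q≡1+e)) α≡))
      where q≡1+e = +-cancelʳ-≡ s q (suc e) (trans (subst (λ A → q + A ≡ s + suc e) A≡s qA) (+-comm s (suc e)))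
    fwd : o ≐ (suc (r + s) , s + suc e , suc s , suc s) → profileᵛ V ≐ (e , suc s + e , r + e , e)
    fwd (_ , qA , AE , A≡1+s) = α≡ , trans qA (+-suc s e) , ∣x∩y∣≡ AE m≡[r+e]+1+s ,
      +-cancelʳ-≡ (suc s) q e (trans (subst (λ A → q + A ≡ s + suc e) A≡1+s qA) (trans (+-suc s e) (+-comm (suc s) e)))
    bwd : profileᵛ V ≐ (e , suc s + e , r + e , e) → o ≐ (suc (r + s) , s + suc e , suc s , suc s)
    bwd (_ , qA , qD , q≡e) = A+C≡ , trans qA (sym (+-suc s e)) , ∣y∖x∣≡ qD m≡[r+e]+1+s ,
      +-cancelˡ-≡ e A (suc s) (trans (subst (λ q → q + A ≡ suc s + e) q≡e qA) (+-comm (suc s) e))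

  step-odd-odd : ∀ {r s e} → m ≡ r + suc s + e → q + B ≡ e →
    countᵛ V (r + s , r , r + suc e , r) ≡ suc s * 𝟙 (profileᵛ V ≐? (e , r , s , 0))
  step-odd-odd {r} {s} {e} m≡ α≡ = begin
    countᵛ V (r + s , r , r + suc e , r)
      ≡⟨ countᵛ-inside-x₀ (r + s) r (r + suc e) r A+C≡ ⟩
    A * 𝟙 (o ≐? (suc (r + s) , r , suc (r + suc e) , suc r)) + C * 𝟙 (o ≐? (suc (r + s) , r , r + suc e , r))
      ≡⟨ cong₂ _+_ (*𝟙-no A (o ≐? _) removing-x₀∩y) (*𝟙-⇔ C s (o ≐? _) (profileᵛ V ≐? _) fwd bwd weight) ⟩
    suc s * 𝟙 (profileᵛ V ≐? (e , r , s , 0)) ∎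
    where
    open ≡-Reasoning
    A+C≡ : A + C ≡ suc (r + s)
    A+C≡ = ∣x₀∖x∣≡ α≡ (trans m≡ (regroup r s e))
      where regroup : ∀ r s e → r + suc s + e ≡ e + suc (r + s)
            regroup = solve-∀
    m≡s+[r+1+e] : m ≡ s + (r + suc e)
    m≡s+[r+1+e] = trans m≡ (regroup r s e)
      where regroup : ∀ r s e → r + suc s + e ≡ s + (r + suc e)
            regroup = solve-∀
    removing-x₀∩y : ¬ (o ≐ (suc (r + s) , r , suc (r + suc e) , suc r))
    removing-x₀∩y (_ , qA , _ , A≡1+r) = m+1+n≢n q (subst (λ A → q + A ≡ r) A≡1+r qA)
    fwd : o ≐ (suc (r + s) , r , r + suc e , r) → profileᵛ V ≐ (e , r , s , 0)
    fwd (_ , qA , AE , A≡r) = α≡ , qA , ∣x∩y∣≡ AE m≡s+[r+1+e] , +-cancelʳ-≡ r q 0 (subst (λ A → q + A ≡ r) A≡r qA)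
    bwd : profileᵛ V ≐ (e , r , s , 0) → o ≐ (suc (r + s) , r , r + suc e , r)
    bwd (_ , qA , qD , q≡0) = A+C≡ , qA , ∣y∖x∣≡ qD m≡s+[r+1+e] , subst (λ q → q + A ≡ r) q≡0 qA
    weight : profileᵛ V ≐ (e , r , s , 0) → C ≡ suc s
    weight Q = +-cancelˡ-≡ r C (suc s) (trans (cong (_+ C) (sym A≡r)) (trans A+C≡ (sym (+-suc r s))))
      where A≡r = proj₂ (proj₂ (proj₂ (bwd Q)))

  step-odd-even : ∀ {r s e} → m ≡ r + suc s + e → q + B ≡ r + suc s →
    countᵛ V (e , r , s , 0) ≡ suc s * 𝟙 (profileᵛ V ≐? (r + suc s , r , r + e , r))
  step-odd-even {r} {s} {e} m≡ α≡ = begin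
    countᵛ V (e , r , s , 0)
      ≡⟨ countᵛ-outside-x₀ e r s 0 (∣x₀∖x∣≡ α≡ m≡) ⟩
    E * 𝟙 (o ≐? (e , r , suc s , 0)) + G * 𝟙 (o ≐? (e , r , s , 0))
      ≡⟨ cong₂ _+_ (*𝟙-⇔ E s (o ≐? _) (profileᵛ V ≐? _) fwd bwd weight) (*𝟙-no G (o ≐? _) removing-outside) ⟩
    suc s * 𝟙 (profileᵛ V ≐? (r + suc s , r , r + e , r)) + 0
      ≡⟨ +-identityʳ _ ⟩
    suc s * 𝟙 (profileᵛ V ≐? (r + suc s , r , r + e , r)) ∎
    where
    open ≡-Reasoning
    m≡[r+e]+1+s : m ≡ (r + e) + suc s
    m≡[r+e]+1+s = trans m≡ (regroup r s e)
      where regroup : ∀ r s e → r + suc s + e ≡ (r + e) + suc s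
            regroup = solve-∀
    q≡r : q + A ≡ r → A ≡ 0 → q ≡ r
    q≡r qA A≡0 = trans (sym (+-identityʳ q)) (subst (λ A → q + A ≡ r) A≡0 qA)
    removing-outside : ¬ (o ≐ (e , r , s , 0))
    removing-outside (_ , qA , AE , A≡0) = m≢1+m+n e {F} (sym (trans (cong (_+ F) (sym D≡1+e)) D+F≡e))
      where
      D+F≡e : D + F ≡ e
      D+F≡e = +-split-cancelˡ size-x α≡ m≡
      qD≡r+1+e : q + D ≡ r + suc e
      qD≡r+1+e = ∣x∩y∣≡ AE (trans m≡ (regroup r s e))
        where regroup : ∀ r s e → r + suc s + e ≡ (r + suc e) + s
              regroup = solve-∀
      D≡1+e : D ≡ suc e
      D≡1+e = +-cancelˡ-≡ r D (suc e) (subst (λ q → q + D ≡ r + suc e) (q≡r qA A≡0) qD≡r+1+e)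
    fwd : o ≐ (e , r , suc s , 0) → profileᵛ V ≐ (r + suc s , r , r + e , r)
    fwd (_ , qA , AE , A≡0) = α≡ , qA , ∣x∩y∣≡ AE m≡[r+e]+1+s , q≡r qA A≡0
    bwd : profileᵛ V ≐ (r + suc s , r , r + e , r) → o ≐ (e , r , suc s , 0)
    bwd (_ , qA , qD , q≡r) = ∣x₀∖x∣≡ α≡ m≡ , qA , ∣y∖x∣≡ qD m≡[r+e]+1+s ,
      +-cancelˡ-≡ r A 0 (trans (subst (λ q → q + A ≡ r) q≡r qA) (sym (+-identityʳ r)))
    weight : profileᵛ V ≐ (r + suc s , r , r + e , r) → E ≡ suc s
    weight Q with bwd Q
    ... | (_ , _ , AE , A≡0) = subst (λ A → A + E ≡ suc s) A≡0 AE

-- The four families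

M-cong : ∀ {m} {P : Mat m} {c c′ a a′ b b′ t t′ p p′} → c ≡ c′ → a ≡ a′ → b ≡ b′ → t ≡ t′ → p ≡ p′ →
  MatEq m P (scale m c (M m a b t p)) → MatEq m P (scale m c′ (M m a′ b′ t′ p′))
M-cong refl refl refl refl refl P≈ = P≈

Pchain-cong : ∀ {m i k k′} {F : Mat m} → k ≡ k′ → MatEq m (Pchain m i k) F → MatEq m (Pchain m i k′) F
Pchain-cong refl P≈ = P≈

[s!]²*[1+s]*[1+s]≡[1+s]!² : ∀ s → (s !) ^ 2 * suc s * suc s ≡ (suc s !) ^ 2
[s!]²*[1+s]*[1+s]≡[1+s]!² s = lemma (s !) s
  where lemma : ∀ f s → f * (f * 1) * suc s * suc s ≡ (suc s * f) * ((suc s * f) * 1)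
        lemma = solve-∀

module Chains (m : ℕ) (1≤m : 1 ≤ m) where

  ∣x₀∩x∣≤m : ∀ x → ∣ x₀ m ∩ x ∣ ≤ m
  ∣x₀∩x∣≤m x = ≤-trans (∣p∩q∣≤∣p∣ (x₀ m) x) (≤-reflexive (∣x₀∣≡m m))

  row-odd : ∀ {a j} → j ≡ 2 * a + 1 → j ≤ m → ∀ x → ∣ x ∣ ≡ m → (dist m (x₀ m) x ≡ᵇ j) ≡ (∣ x₀ m ∩ x ∣ ≡ᵇ a)
  row-odd {a} refl j≤m x _ = distance-odd m ∣ x₀ m ∩ x ∣ a j≤m

  row-even : ∀ {e E j} → j ≡ 2 * e → E + e ≡ m → j ≤ m → ∀ x → ∣ x ∣ ≡ m → (dist m (x₀ m) x ≡ᵇ j) ≡ (∣ x₀ m ∩ x ∣ ≡ᵇ E)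
  row-even {e} {E} refl E+e≡m j≤m x _ = distance-even m ∣ x₀ m ∩ x ∣ e E 1≤m E+e≡m j≤m (∣x₀∩x∣≤m x)

  mutual
    even-even : ∀ r s e → m ≡ r + s + e → 2 * r + 2 * s ≤ m →
      MatEq m (Pchain m (2 * r) (2 * s)) (scale m ((s !) ^ 2) (M m e (s + e) (r + e) e))
    even-even r zero e m≡ le =
      M-cong {c = 1} {a = e} {b = e} {p = e} refl refl refl (trans m≡ (cong (_+ e) (+-identityʳ r))) refl
             (E*-as-M m (2 * r) e (row-even {r} {e} refl (trans (+-comm e r) (sym m≡′)) (subst (_≤ m) (+-identityʳ _) le)))
      where m≡′ = trans m≡ (cong (_+ e) (+-identityʳ r))
    even-even r (suc s) e m≡ le =
      Pchain-cong (k≡ s) (M-cong ([s!]²*[1+s]*[1+s]≡[1+s]!² s) refl refl refl refl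
        (chain-step m (2 * r) (suc (2 * s)) ((s !) ^ 2 * suc s) s
                    (even-odd r s (suc e) (trans m≡ (regroup r s e)) (≤-trans (+-monoʳ-≤ (2 * r) (n≤1+n _)) le′))
                    (row-even (j≡ r s) (trans (+-comm e _) (sym m≡)) le′) (λ V → step-even-even V m≡)))
      where
      k≡ : ∀ s → suc (suc (2 * s)) ≡ 2 * suc s
      k≡ = solve-∀
      j≡ : ∀ r s → 2 * r + suc (suc (2 * s)) ≡ 2 * (r + suc s)
      j≡ = solve-∀
      regroup : ∀ r s e → r + suc s + e ≡ r + s + suc e
      regroup = solve-∀
      le′ : 2 * r + suc (suc (2 * s)) ≤ m
      le′ = subst (λ k → 2 * r + k ≤ m) (sym (k≡ s)) le

    even-odd : ∀ r s e → m ≡ r + s + e → 2 * r + suc (2 * s) ≤ m →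
      MatEq m (Pchain m (2 * r) (suc (2 * s))) (scale m ((s !) ^ 2 * suc s) (M m (r + s) (s + e) s s))
    even-odd r s e m≡ le =
      chain-step m (2 * r) (2 * s) ((s !) ^ 2) s (even-even r s e m≡ (≤-trans (+-monoʳ-≤ (2 * r) (n≤1+n _)) le))
                 (row-odd (j≡ r s) le) (λ V → step-even-odd V m≡)
      where j≡ : ∀ r s → 2 * r + suc (2 * s) ≡ 2 * (r + s) + 1
            j≡ = solve-∀

    odd-even : ∀ r s e → m ≡ r + s + e → suc (2 * r) + 2 * s ≤ m →
      MatEq m (Pchain m (suc (2 * r)) (2 * s)) (scale m ((s !) ^ 2) (M m (r + s) r (r + e) r))
    odd-even r zero e m≡ le =
      M-cong {c = 1} {a = r} {b = r} {p = r} refl (sym (+-identityʳ r)) refl (trans m≡ (cong (_+ e) (+-identityʳ r))) refl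
             (E*-as-M m (suc (2 * r)) r (row-odd {r} (+-comm 1 (2 * r)) (subst (_≤ m) (+-identityʳ _) le)))
    odd-even r (suc s) e m≡ le =
      Pchain-cong (k≡ s) (M-cong ([s!]²*[1+s]*[1+s]≡[1+s]!² s) refl refl refl refl
        (chain-step m (suc (2 * r)) (suc (2 * s)) ((s !) ^ 2 * suc s) s
                    (odd-odd r s e m≡ (≤-trans (+-monoʳ-≤ (suc (2 * r)) (n≤1+n _)) le′))
                    (row-odd (j≡ r s) le′) (λ V → step-odd-even V m≡)))
      where
      k≡ : ∀ s → suc (suc (2 * s)) ≡ 2 * suc s
      k≡ = solve-∀
      j≡ : ∀ r s → suc (2 * r) + suc (suc (2 * s)) ≡ 2 * (r + suc s) + 1
      j≡ = solve-∀
      le′ : suc (2 * r) + suc (suc (2 * s)) ≤ m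
      le′ = subst (λ k → suc (2 * r) + k ≤ m) (sym (k≡ s)) le

    odd-odd : ∀ r s e → m ≡ r + suc s + e → suc (2 * r) + suc (2 * s) ≤ m →
      MatEq m (Pchain m (suc (2 * r)) (suc (2 * s))) (scale m ((s !) ^ 2 * suc s) (M m e r s 0))
    odd-odd r s e m≡ le =
      chain-step m (suc (2 * r)) (2 * s) ((s !) ^ 2) s
                 (odd-even r s (suc e) (trans m≡ (regroup r s e)) (≤-trans (+-monoʳ-≤ (suc (2 * r)) (n≤1+n _)) le))
                 (row-even {r + suc s} {e} (j≡ r s) (trans (+-comm e _) (sym m≡)) le) (λ V → step-odd-odd V m≡)
      where
      j≡ : ∀ r s → suc (2 * r) + suc (2 * s) ≡ 2 * (r + suc s)
      j≡ = solve-∀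
      regroup : ∀ r s e → r + suc s + e ≡ r + s + suc e
      regroup = solve-∀

m≡2*n⇒n≡m/2 : ∀ n {m} → m ≡ 2 * n → n ≡ m / 2
m≡2*n⇒n≡m/2 n refl = sym (trans (cong (_/ 2) (*-comm 2 n)) (m*n/n≡m n 2))

m≡n+o⇒m∸n≡o : ∀ {m} n {o} → m ≡ n + o → m ∸ n ≡ o
m≡n+o⇒m∸n≡o n {o} refl = m+n∸m≡n n o

case-i : ∀ m i k r s e → 1 ≤ m → i ≡ 2 * r → k ≡ suc (2 * s) → m ≡ r + s + e → i + k ≤ m →
  MatEq m (Pchain m i k) (scale m ((((k ∸ 1) / 2) !) ^ 2 * ((k + 1) / 2)) (M m ((i + k ∸ 1) / 2) ((2 * m ∸ i) / 2) ((k ∸ 1) / 2) ((k ∸ 1) / 2)))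
case-i _ _ _ r s e 1≤m refl refl refl i+k≤m =
  M-cong (cong₂ (λ a b → (a !) ^ 2 * b) (m≡2*n⇒n≡m/2 s refl) (m≡2*n⇒n≡m/2 (suc s) (k+1≡ s)))
         (m≡2*n⇒n≡m/2 (r + s) (cong (_∸ 1) (i+k≡ r s)))
         (m≡2*n⇒n≡m/2 (s + e) (m≡n+o⇒m∸n≡o (2 * r) (2m≡ r s e)))
         (m≡2*n⇒n≡m/2 s refl)
         (m≡2*n⇒n≡m/2 s refl)
         (Chains.even-odd (r + s + e) 1≤m r s e refl i+k≤m)
  where
  k+1≡ : ∀ s → suc (2 * s) + 1 ≡ 2 * suc s
  k+1≡ = solve-∀
  i+k≡ : ∀ r s → 2 * r + suc (2 * s) ≡ suc (2 * (r + s))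
  i+k≡ = solve-∀
  2m≡ : ∀ r s e → 2 * (r + s + e) ≡ 2 * r + 2 * (s + e)
  2m≡ = solve-∀

case-ii : ∀ m i k r s e → 1 ≤ m → i ≡ 2 * r → k ≡ 2 * s → m ≡ r + s + e → i + k ≤ m →
  MatEq m (Pchain m i k) (scale m (((k / 2) !) ^ 2) (M m ((2 * m ∸ i ∸ k) / 2) ((2 * m ∸ i) / 2) ((2 * m ∸ k) / 2) ((2 * m ∸ i ∸ k) / 2)))
case-ii _ _ _ r s e 1≤m refl refl refl i+k≤m =
  M-cong (cong (λ a → (a !) ^ 2) (m≡2*n⇒n≡m/2 s refl))
         (m≡2*n⇒n≡m/2 e 2m∸i∸k≡)
         (m≡2*n⇒n≡m/2 (s + e) (m≡n+o⇒m∸n≡o (2 * r) (2m≡ r s e)))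
         (m≡2*n⇒n≡m/2 (r + e) (m≡n+o⇒m∸n≡o (2 * s) (2m≡′ r s e)))
         (m≡2*n⇒n≡m/2 e 2m∸i∸k≡)
         (Chains.even-even (r + s + e) 1≤m r s e refl i+k≤m)
  where
  2m≡ : ∀ r s e → 2 * (r + s + e) ≡ 2 * r + 2 * (s + e)
  2m≡ = solve-∀
  2m≡′ : ∀ r s e → 2 * (r + s + e) ≡ 2 * s + 2 * (r + e)
  2m≡′ = solve-∀
  2m∸i∸k≡ : 2 * (r + s + e) ∸ 2 * r ∸ 2 * s ≡ 2 * e
  2m∸i∸k≡ = m≡n+o⇒m∸n≡o (2 * s) (trans (m≡n+o⇒m∸n≡o (2 * r) (2m≡ r s e)) (*-distribˡ-+ 2 s e))

case-iii : ∀ m i k r s e → 1 ≤ m → i ≡ suc (2 * r) → k ≡ suc (2 * s) → m ≡ r + suc s + e → i + k ≤ m →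
  MatEq m (Pchain m i k) (scale m ((((k ∸ 1) / 2) !) ^ 2 * ((k + 1) / 2)) (M m ((2 * m ∸ i ∸ k) / 2) ((i ∸ 1) / 2) ((k ∸ 1) / 2) 0))
case-iii _ _ _ r s e 1≤m refl refl refl i+k≤m =
  M-cong (cong₂ (λ a b → (a !) ^ 2 * b) (m≡2*n⇒n≡m/2 s refl) (m≡2*n⇒n≡m/2 (suc s) (k+1≡ s)))
         (m≡2*n⇒n≡m/2 e (m≡n+o⇒m∸n≡o (suc (2 * s)) (m≡n+o⇒m∸n≡o (suc (2 * r)) (2m≡ r s e))))
         (m≡2*n⇒n≡m/2 r refl)
         (m≡2*n⇒n≡m/2 s refl)
         refl
         (Chains.odd-odd (r + suc s + e) 1≤m r s e refl i+k≤m)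
  where
  k+1≡ : ∀ s → suc (2 * s) + 1 ≡ 2 * suc s
  k+1≡ = solve-∀
  2m≡ : ∀ r s e → 2 * (r + suc s + e) ≡ suc (2 * r) + (suc (2 * s) + 2 * e)
  2m≡ = solve-∀

case-iv : ∀ m i k r s e → 1 ≤ m → i ≡ suc (2 * r) → k ≡ 2 * s → m ≡ r + s + e → i + k ≤ m →
  MatEq m (Pchain m i k) (scale m (((k / 2) !) ^ 2) (M m ((i + k ∸ 1) / 2) ((i ∸ 1) / 2) ((2 * m ∸ k) / 2) ((i ∸ 1) / 2)))
case-iv _ _ _ r s e 1≤m refl refl refl i+k≤m =
  M-cong (cong (λ a → (a !) ^ 2) (m≡2*n⇒n≡m/2 s refl))
         (m≡2*n⇒n≡m/2 (r + s) (i+k∸1≡ r s))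
         (m≡2*n⇒n≡m/2 r refl)
         (m≡2*n⇒n≡m/2 (r + e) (m≡n+o⇒m∸n≡o (2 * s) (2m≡ r s e)))
         (m≡2*n⇒n≡m/2 r refl)
         (Chains.odd-even (r + s + e) 1≤m r s e refl i+k≤m)
  where
  i+k∸1≡ : ∀ r s → 2 * r + 2 * s ≡ 2 * (r + s)
  i+k∸1≡ = solve-∀
  2m≡ : ∀ r s e → 2 * (r + s + e) ≡ 2 * s + 2 * (r + e)
  2m≡ = solve-∀

n%2≡0⇒n≡2*[n/2] : ∀ n → n % 2 ≡ 0 → n ≡ 2 * (n / 2)
n%2≡0⇒n≡2*[n/2] n n%2≡0 = trans (m≡m%n+[m/n]*n n 2) (trans (cong (_+ n / 2 * 2) n%2≡0) (*-comm (n / 2) 2))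

n%2≡1⇒n≡1+2*[n/2] : ∀ n → n % 2 ≡ 1 → n ≡ suc (2 * (n / 2))
n%2≡1⇒n≡1+2*[n/2] n n%2≡1 = trans (m≡m%n+[m/n]*n n 2) (trans (cong (_+ n / 2 * 2) n%2≡1) (cong suc (*-comm (n / 2) 2)))

lemma5p1 : (m i k : ℕ) → 3 ≤ m → i ≤ m → k ≤ m → i + k ≤ m →
    ((i % 2 ≡ 0 → k % 2 ≡ 1 →
        MatEq m (Pchain m i k) (scale m ((((k ∸ 1) / 2) !) ^ 2 * ((k + 1) / 2)) (M m ((i + k ∸ 1) / 2) ((2 * m ∸ i) / 2) ((k ∸ 1) / 2) ((k ∸ 1) / 2))))
    × (i % 2 ≡ 0 → k % 2 ≡ 0 → 2 ≤ k →
        MatEq m (Pchain m i k) (scale m (((k / 2) !) ^ 2) (M m ((2 * m ∸ i ∸ k) / 2) ((2 * m ∸ i) / 2) ((2 * m ∸ k) / 2) ((2 * m ∸ i ∸ k) / 2))))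
    × (i % 2 ≡ 1 → k % 2 ≡ 1 →
        MatEq m (Pchain m i k) (scale m ((((k ∸ 1) / 2) !) ^ 2 * ((k + 1) / 2)) (M m ((2 * m ∸ i ∸ k) / 2) ((i ∸ 1) / 2) ((k ∸ 1) / 2) 0)))
    × (i % 2 ≡ 1 → k % 2 ≡ 0 → 2 ≤ k →
        MatEq m (Pchain m i k) (scale m (((k / 2) !) ^ 2) (M m ((i + k ∸ 1) / 2) ((i ∸ 1) / 2) ((2 * m ∸ k) / 2) ((i ∸ 1) / 2)))))
lemma5p1 m i k 3≤m _ _ i+k≤m =
    (λ i-even k-odd   → case-i   m i k r s _ 1≤m (n%2≡0⇒n≡2*[n/2] i i-even) (n%2≡1⇒n≡1+2*[n/2] k k-odd) m≡r+s+e i+k≤m)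
  , (λ i-even k-even _ → case-ii  m i k r s _ 1≤m (n%2≡0⇒n≡2*[n/2] i i-even) (n%2≡0⇒n≡2*[n/2] k k-even) m≡r+s+e i+k≤m)
  , (λ i-odd k-odd    → case-iii m i k r s _ 1≤m (n%2≡1⇒n≡1+2*[n/2] i i-odd) (n%2≡1⇒n≡1+2*[n/2] k k-odd) (m≡r+1+s+e k-odd) i+k≤m)
  , (λ i-odd k-even _ → case-iv  m i k r s _ 1≤m (n%2≡1⇒n≡1+2*[n/2] i i-odd) (n%2≡0⇒n≡2*[n/2] k k-even) m≡r+s+e i+k≤m)
  where
  r = i / 2
  s = k / 2
  1≤m : 1 ≤ m
  1≤m = ≤-trans (s≤s z≤n) 3≤m
  m≡r+s+e : m ≡ r + s + (m ∸ (r + s))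
  m≡r+s+e = sym (m+[n∸m]≡n (≤-trans (+-mono-≤ (m/n≤m i 2) (m/n≤m k 2)) i+k≤m))
  m≡r+1+s+e : k % 2 ≡ 1 → m ≡ r + suc s + (m ∸ (r + suc s))
  m≡r+1+s+e k-odd = sym (m+[n∸m]≡n (≤-trans (+-mono-≤ (m/n≤m i 2) 1+s≤k) i+k≤m))
    where 1+s≤k = subst (suc s ≤_) (sym (n%2≡1⇒n≡1+2*[n/2] k k-odd)) (s≤s (m≤m+n s (s + 0)))
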